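{- Let $\overline{\Gamma}$ be a uniform tour of a driver starting and ending in depot $v_D$ (with empty convoy at start and end), let $\mathrm{TR}$ be a set of transport requests for $\overline{\Gamma}$, and let $G^t=(V^+\cup V^-\cup V^=,A\cup A^t,w)$ be the transport graph for $\overline{\Gamma}$ and $\mathrm{TR}$. Let $\overline{\Gamma}'$ be the tour constructed by the construction algorithm described in the context, and let $f^a:A\to\mathbb{N}$ be its traverse counter function. Then $f^a(a)\le L+1$ for all tour arcs $a\in A$. More specifically, $f^a(a)\le L+1$ for every tour arc $a=(v,w)\in A$ with $v\in V^-$, and $f^a(a')\le L$ for every tour arc $a'=(v',w')\in A$ with $v'\in V^+$.
   Context: Convoy capacity $L\in\mathbb{N}$. An action $(j,v,t,x)$ of driver $j$ at station $v$ at time $t$ loads $x$ cars ($x>0$, pickup) or unloads $|x|$ cars ($x<0$, drop), $|x|\le L$; a move $(j,v,t_v,v',t_{v'},x)$ carries $x$ cars, $0\le x\le L$, from $v$ to $v'$ with travel length $d(v,v')$ given by a quasi-metric $d$ (nonnegative, $d(v,v')=0$ iff $v=v'$, triangle inequality). A tour is an alternating sequence $(m_1,\alpha_1,\dots,\alpha_{n-1},m_n)$ of moves and actions of one driver with consistent locations and times and with load of $m_{i+1}$ = load of $m_i$ + $x$ of $\alpha_i$. It is uniform if every action has $x\in\{1,-1\}$. Tour graph of $\overline{\Gamma}$: node set $V^+\cup V^-\cup V^=$ where $V^+$ (resp. $V^-$) are the pickup (resp. drop) actions of $\overline{\Gamma}$ and $V^=$ consists of one node for the depot; tour arcs $A$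 go from each action to the next action, from the depot node to the first action and from the last action to the depot node, weighted by the distance of the corresponding move. A transport request is $(v,v',x)$ meaning $x$ cars to be moved from station $v$ to $v'$; it is uniform if $x=1$. A set $\mathrm{TR}$ of uniform transport requests for $\overline{\Gamma}$ is given together with an assignment of each request to one pickup action (at its origin) and one drop action (at its destination) of $\overline{\Gamma}$, every action being assigned to exactly one request. The transport graph $G^t$ adds, for each request, a transport arc $A^t$ from its assigned pickup node to its assigned drop node, weighted by the distance between their locations. Construction algorithm: start with current node the depot node; while not every node of $V^+$ has been visited: if the current node is an unvisited pickup node, mark it visited and traverse its transport arc (adding the corresponding pickup action, a move carrying one car, and the drop action to the new tour); otherwise traverse the tour arc leaving the current node (adding an empty move); update the current node. Afterwards follow tour arcs until the depot node is reached; insert empty actions between successive moves where necessary. The traverse counter function $f^a:A\to\mathbb{N}$ gives, for each tour arc, the number of times it is traversed by this construction. -}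

module Defs where

open import Data.Nat using (ℕ; zero; suc; _+_; _<_; _≤_)
open import Data.Nat.DivMod using (_mod_)
open import Data.Fin using (Fin; zero; suc; toℕ; _≟_)
  renaming (_<_ to _<ᶠ_)
open import Data.Bool using (Bool; true; false; if_then_else_)
open import Data.Vec using (Vec; []; _∷_; lookup)
open import Data.Product using (Σ; ∃; _×_; _,_)
open import Data.Sum using (_⊎_)
open import Relation.Nullary using (¬_)
open import Relation.Nullary.Decidable using (⌊_⌋)
open import Relation.Binary.PropositionalEquality using (_≡_)
open import Function.Definitions using (Injective)

-- Uniform actions: every action loads (+1) or unloads (-1) one car.

data Sign : Set where
  pick drop : Sign

record Action (V : Set) : Set where
  constructor act
  field
    station : V
    sign    : Sign
open Action public

data Feasible (L : ℕ) : ℕ → {k : ℕ} → Vec Sign k → Set where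
  done  : Feasible L 0 []
  pickF : ∀ {ℓ k} {s : Vec Sign k} → ℓ < L → Feasible L (suc ℓ) s →
          Feasible L ℓ (pick ∷ s)
  dropF : ∀ {ℓ k} {s : Vec Sign k} → Feasible L ℓ s →
          Feasible L (suc ℓ) (drop ∷ s)

signs : ∀ {V : Set} {n} → Vec (Action V) n → Vec Sign n
signs [] = []
signs (a ∷ as) = sign a ∷ signs as

-- A uniform tour of one driver starting and ending in the depot with an
-- empty convoy, given by its sequence of n actions (moves in between
-- are determined by the stations; the depot is the start/end point).
record UniformTour (V : Set) (vD : V) (L : ℕ) (n : ℕ) : Set where
  field
    actions  : Vec (Action V) n
    feasible : Feasible L 0 (signs actions)
open UniformTour public

sgn : ∀ {V vD L n} → UniformTour V vD L n → Fin n → Sign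
sgn Γ i = sign (lookup (actions Γ) i)

stn : ∀ {V vD L n} → UniformTour V vD L n → Fin n → V
stn Γ i = station (lookup (actions Γ) i)

-- Uniform transport requests (v, v', 1), with their assigned pickup and
-- drop actions of the tour.

record Request (V : Set) (n : ℕ) : Set where
  constructor req
  field
    origin  : V
    dest    : V
    pickAct : Fin n
    dropAct : Fin n
open Request public

record TransportRequests {V vD L n} (Γ : UniformTour V vD L n) : Set where
  field
    m        : ℕ
    requests : Fin m → Request V n
    pick-ok  : ∀ r → sgn Γ (pickAct (requests r)) ≡ pick
    drop-ok  : ∀ r → sgn Γ (dropAct (requests r)) ≡ drop
    orig-ok  : ∀ r → stn Γ (pickAct (requests r)) ≡ origin (requests r)
    dest-ok  : ∀ r → stn Γ (dropAct (requests r)) ≡ dest (requests r)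
    order-ok : ∀ r → pickAct (requests r) <ᶠ dropAct (requests r)
    pick-inj : Injective _≡_ _≡_ (λ r → pickAct (requests r))
    drop-inj : Injective _≡_ _≡_ (λ r → dropAct (requests r))
    covers   : ∀ i → ∃ λ r → pickAct (requests r) ≡ i ⊎ dropAct (requests r) ≡ i
open TransportRequests public

-- Tour graph: nodes Fin (suc n); zero = depot node, suc i = action i.
-- Each node has exactly one outgoing tour arc (to the next node of the
-- cyclic tour), so tour arcs are identified with their source node.

Node : ℕ → Set
Node n = Fin (suc n)

next : ∀ {n} → Node n → Node n
next {n} k = suc (toℕ k) mod (suc n)

mark : ∀ {n} → Fin n → (Fin n → Bool) → Fin n → Bool
mark i vis j = if ⌊ j ≟ i ⌋ then true else vis j

inc : ∀ {n} → Node n → (Node n → ℕ) → Node n → ℕ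
inc a f b = if ⌊ b ≟ a ⌋ then suc (f b) else f b

-- The construction algorithm, as a (deterministic) big-step relation.

module Construction {V : Set} {vD : V} {L n : ℕ}
                    (Γ : UniformTour V vD L n) (TR : TransportRequests Γ) where

  AllPickupsVisited : (Fin n → Bool) → Set
  AllPickupsVisited vis = ∀ i → sgn Γ i ≡ pick → vis i ≡ true

  UnvisitedPickup : Node n → (Fin n → Bool) → Set
  UnvisitedPickup cur vis =
    ∃ λ i → cur ≡ suc i × sgn Γ i ≡ pick × vis i ≡ false

  -- Main loop: Loop cur vis cnt end cnt' means: started at current node
  -- cur with visited set vis and traverse counters cnt, the while-loop
  -- terminates at node end with counters cnt'.
  data Loop : Node n → (Fin n → Bool) → (Node n → ℕ) →
              Node n → (Node n → ℕ) → Set where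
    stop     : ∀ {cur vis cnt} → AllPickupsVisited vis →
               Loop cur vis cnt cur cnt
    viaTrans : ∀ {vis cnt e cnt'} (r : Fin (m TR)) →
               ¬ AllPickupsVisited vis →
               vis (pickAct (requests TR r)) ≡ false →
               Loop (suc (dropAct (requests TR r)))
                    (mark (pickAct (requests TR r)) vis) cnt e cnt' →
               Loop (suc (pickAct (requests TR r))) vis cnt e cnt'
    viaTour  : ∀ {cur vis cnt e cnt'} →
               ¬ AllPickupsVisited vis →
               ¬ UnvisitedPickup cur vis →
               Loop (next cur) vis (inc cur cnt) e cnt' →
               Loop cur vis cnt e cnt'

  data Return : Node n → (Node n → ℕ) → (Node n → ℕ) → Set where
    atDepot : ∀ {cnt} → Return zero cnt cnt
    step    : ∀ {i cnt cnt'} →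
              Return (next (suc i)) (inc (suc i) cnt) cnt' →
              Return (suc i) cnt cnt'

  TraverseCounter : (Node n → ℕ) → Set
  TraverseCounter f =
    Σ (Node n) λ e → Σ (Node n → ℕ) λ cnt →
      Loop zero (λ _ → false) (λ _ → 0) e cnt × Return e cnt f

-- Call a traversal of the depot arc the start of a round. Within a round every tour arc is
-- traversed at most once, so it suffices that at most L rounds start. A round starts only while
-- some pickup p is unvisited; each earlier round went past p without stopping, hence jumped over
-- p along the transport arc of a visited request picked before p and dropped after it. These
-- arcs are distinct, and their cars are all on board in Γ when p is loaded, so there are fewer
-- than L of them. This bounds every tour arc by L, which gives the stated bounds.
module Submission where

open import Defs
open import Data.Nat using (ℕ; suc; _+_; _≤_)
open import Data.Fin using (Fin)
open import Data.Product using (Σ; _×_)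
open import Relation.Binary.PropositionalEquality using (_≡_)

open import Level using (0ℓ)
open import Function using (_∘_; id; _∋_)
open import Data.Nat using (zero; _<_; _∸_; z≤n; s≤s; z<s; s<s; _<?_; _≤?_)
open import Data.Nat.Properties
open import Data.Nat.DivMod using (_%_; m<n⇒m%n≡m; n%n≡0)
open import Data.Fin using (zero; suc; toℕ; fromℕ<) renaming (_<_ to _<ᶠ_; _≤_ to _≤ᶠ_)
import Data.Fin.Properties as Finₚ
open import Data.Fin.Properties using (toℕ<n; toℕ-fromℕ<; toℕ-injective; any?)
open import Data.Bool using (Bool; true; false)
import Data.Bool.Properties as Boolₚ
open import Data.Vec using (Vec; _∷_; lookup)
open import Data.Product using (∃; ∃₂; _,_; proj₁; proj₂)
import Data.Product as Product
open import Data.Sum using (_⊎_; inj₁; inj₂; [_,_]′)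
open import Data.Empty using (⊥; ⊥-elim)
open import Relation.Binary using (tri<; tri≈; tri>)
open import Relation.Binary.PropositionalEquality
  using (_≢_; ≢-sym; refl; sym; trans; cong; subst; module ≡-Reasoning)
open import Relation.Nullary using (Dec; yes; no; ¬_)
open import Relation.Nullary.Decidable using (_×-dec_; map′; decidable-stable)
open import Relation.Unary using (Pred; Decidable; _⊆_)
open import Algebra.Properties.Monoid.Sum +-0-monoid using (sum; sum-replicate-zero)
open import Algebra.Properties.CommutativeSemigroup +-commutativeSemigroup using (x∙yz≈y∙xz)

sum-mono : ∀ {k} {f g : Fin k → ℕ} → (∀ r → f r ≤ g r) → sum f ≤ sum g
sum-mono {zero}  f≤g = z≤n
sum-mono {suc k} f≤g = +-mono-≤ (f≤g zero) (sum-mono (f≤g ∘ suc))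

sum-mono-< : ∀ {k} {f g : Fin k → ℕ} → (∀ r → f r ≤ g r) →
             ∀ a → f a < g a → sum f < sum g
sum-mono-< f≤g zero    fa<ga = +-mono-<-≤ fa<ga (sum-mono (f≤g ∘ suc))
sum-mono-< f≤g (suc a) fa<ga = +-mono-≤-< (f≤g zero) (sum-mono-< (f≤g ∘ suc) a fa<ga)

sum-mono-except : ∀ {k} {f g : Fin k → ℕ} (a : Fin k) {d} →
                  (∀ r → r ≢ a → f r ≤ g r) → f a ≤ d + g a → sum f ≤ d + sum g
sum-mono-except {suc k} {f} {g} zero {d} f≤g fa≤ = begin
  f zero + sum (f ∘ suc)     ≤⟨ +-mono-≤ fa≤ (sum-mono λ r → f≤g (suc r) λ ()) ⟩
  d + g zero + sum (g ∘ suc) ≡⟨ +-assoc d _ _ ⟩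
  d + sum g                  ∎
  where open ≤-Reasoning
sum-mono-except {suc k} {f} {g} (suc a) {d} f≤g fa≤ = begin
  f zero + sum (f ∘ suc)       ≤⟨ +-mono-≤ (f≤g zero λ ()) (sum-mono-except a f≤g′ fa≤) ⟩
  g zero + (d + sum (g ∘ suc)) ≡⟨ x∙yz≈y∙xz (g zero) d _ ⟩
  d + sum g                    ∎
  where
  open ≤-Reasoning
  f≤g′ : ∀ r → r ≢ a → f (suc r) ≤ g (suc r)
  f≤g′ r r≢a = f≤g (suc r) (r≢a ∘ Finₚ.suc-injective)

indicator : ∀ {a} {A : Set a} → Dec A → ℕ
indicator (yes _) = 1
indicator (no _)  = 0

indicator-mono : ∀ {a b} {A : Set a} {B : Set b} (A? : Dec A) (B? : Dec B) →
                 (A → B) → indicator A? ≤ indicator B?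
indicator-mono (yes a) (yes _) _   = ≤-refl
indicator-mono (yes a) (no ¬b) a→b = ⊥-elim (¬b (a→b a))
indicator-mono (no _)  _       _   = z≤n

indicator-mono-< : ∀ {a b} {A : Set a} {B : Set b} (A? : Dec A) (B? : Dec B) →
                   ¬ A → B → indicator A? < indicator B?
indicator-mono-< (yes a) _       ¬a _ = ⊥-elim (¬a a)
indicator-mono-< (no _)  (yes _) _  _ = z<s
indicator-mono-< (no _)  (no ¬b) _  b = ⊥-elim (¬b b)

indicator≤1 : ∀ {a} {A : Set a} (A? : Dec A) → indicator A? ≤ 1
indicator≤1 (yes _) = ≤-refl
indicator≤1 (no _)  = z≤n

count : ∀ {k p} {P : Pred (Fin k) p} → Decidable P → ℕ
count P? = sum λ r → indicator (P? r)

module _ {k p q} {P : Pred (Fin k) p} {Q : Pred (Fin k) q}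
         (P? : Decidable P) (Q? : Decidable Q) where

  count-mono : P ⊆ Q → count P? ≤ count Q?
  count-mono P⊆Q = sum-mono λ r → indicator-mono (P? r) (Q? r) P⊆Q

  count-mono-< : P ⊆ Q → ∀ a → ¬ P a → Q a → count P? < count Q?
  count-mono-< P⊆Q a ¬Pa Qa =
    sum-mono-< (λ r → indicator-mono (P? r) (Q? r) P⊆Q) a (indicator-mono-< (P? a) (Q? a) ¬Pa Qa)

  count-≤-suc : ∀ a → (∀ r → Q r → P r ⊎ r ≡ a) → count Q? ≤ suc (count P?)
  count-≤-suc a Q⊆P+a = sum-mono-except a Q≤P (≤-trans (indicator≤1 (Q? a)) (m≤m+n 1 _))
    where
    Q≤P : ∀ r → r ≢ a → indicator (Q? r) ≤ indicator (P? r)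
    Q≤P r r≢a = indicator-mono (Q? r) (P? r) ([ id , ⊥-elim ∘ r≢a ]′ ∘ Q⊆P+a r)

count-empty : ∀ {k p} {P : Pred (Fin k) p} (P? : Decidable P) → (∀ r → ¬ P r) → count P? ≡ 0
count-empty {k} P? none = n≤0⇒n≡0 (begin
  count P?           ≤⟨ sum-mono (λ r → indicator-mono (P? r) (Dec ⊥ ∋ no id) (none r)) ⟩
  sum {k} (λ _ → 0)  ≡⟨ sum-replicate-zero k ⟩
  0                  ∎)
  where open ≤-Reasoning

LoadStep : ℕ → Sign → ℕ → ℕ → Set
LoadStep L pick ℓ ℓ′ = ℓ < L × ℓ′ ≡ suc ℓ
LoadStep L drop ℓ ℓ′ = ℓ ≡ suc ℓ′

loadAfter : ∀ {L ℓ k} {s : Vec Sign k} → Feasible L ℓ s → ℕ → ℕ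
loadAfter {ℓ = ℓ} _ zero = ℓ
loadAfter done        (suc t) = 0
loadAfter (pickF _ F) (suc t) = loadAfter F t
loadAfter (dropF F)   (suc t) = loadAfter F t

loadAfter-step : ∀ {L ℓ k} {s : Vec Sign k} (F : Feasible L ℓ s) (j : Fin k) →
                 LoadStep L (lookup s j) (loadAfter F (toℕ j)) (loadAfter F (suc (toℕ j)))
loadAfter-step (pickF ℓ<L _) zero    = ℓ<L , refl
loadAfter-step (dropF _)     zero    = refl
loadAfter-step (pickF _ F)   (suc j) = loadAfter-step F j
loadAfter-step (dropF F)     (suc j) = loadAfter-step F j

lookup-signs : ∀ {V : Set} {k} (as : Vec (Action V) k) (i : Fin k) →
               lookup (signs as) i ≡ sign (lookup as i)
lookup-signs (_ ∷ _)  zero    = refl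
lookup-signs (_ ∷ as) (suc i) = lookup-signs as i

is-pick? : ∀ s → Dec (s ≡ pick)
is-pick? pick = yes refl
is-pick? drop = no λ ()

mark-self : ∀ {k} (i : Fin k) vis → mark i vis i ≡ true
mark-self i vis with i Finₚ.≟ i
... | yes _  = refl
... | no i≢i = ⊥-elim (i≢i refl)

mark-mono : ∀ {k} (i : Fin k) vis j → vis j ≡ true → mark i vis j ≡ true
mark-mono i vis j visj with j Finₚ.≟ i
... | yes _ = refl
... | no _  = visj

mark-false : ∀ {k} (i : Fin k) vis j → mark i vis j ≡ false → vis j ≡ false
mark-false i vis j markj with j Finₚ.≟ i
... | yes _ with () ← markj
... | no _  = markj

inc-self : ∀ {n} (a : Node n) f → inc a f a ≡ suc (f a)
inc-self a f with a Finₚ.≟ a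
... | yes _  = refl
... | no a≢a = ⊥-elim (a≢a refl)

inc-other : ∀ {n} (a : Node n) f {b} → b ≢ a → inc a f b ≡ f b
inc-other a f {b} b≢a with b Finₚ.≟ a
... | yes b≡a = ⊥-elim (b≢a b≡a)
... | no _    = refl

≤-inc : ∀ {n} (a : Node n) f b → f b ≤ inc a f b
≤-inc a f b with b Finₚ.≟ a
... | yes _ = n≤1+n (f b)
... | no _  = ≤-refl

toℕ-next : ∀ {n} (k : Node n) → toℕ k < n → toℕ (next k) ≡ suc (toℕ k)
toℕ-next {n} k k<n = trans (toℕ-fromℕ< _) (m<n⇒m%n≡m (s≤s k<n))

next-last : ∀ {n} (k : Node n) → toℕ k ≡ n → next k ≡ zero
next-last {n} k k≡n = toℕ-injective (trans (toℕ-fromℕ< _)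
  (subst (λ t → suc t % suc n ≡ 0) (sym k≡n) (n%n≡0 (suc n))))

next-cases : ∀ {n} (k : Node n) →
             (toℕ k < n × toℕ (next k) ≡ suc (toℕ k)) ⊎ (toℕ k ≡ n × next k ≡ zero)
next-cases k with m≤n⇒m<n∨m≡n (≤-pred (toℕ<n k))
... | inj₁ k<n = inj₁ (k<n , toℕ-next k k<n)
... | inj₂ k≡n = inj₂ (k≡n , next-last k k≡n)

<next⇒≤ : ∀ {n} {k a : Node n} → next k ≡ zero ⊎ a <ᶠ next k → a ≤ᶠ k
<next⇒≤ {k = k} {a} a<next with next-cases k
... | inj₂ (k≡n , _) = subst (toℕ a ≤_) (sym k≡n) (≤-pred (toℕ<n a))
... | inj₁ (_ , next≡) with a<next
...   | inj₁ next≡0 with () ← trans (sym next≡) (cong toℕ next≡0)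
...   | inj₂ a<next′ = ≤-pred (subst (toℕ a <_) next≡ a<next′)

module _ {V : Set} {vD : V} {L n : ℕ} (Γ : UniformTour V vD L n) (TR : TransportRequests Γ) where
  open Construction Γ TR

  pickup dropoff : Fin (m TR) → Fin n
  pickup  r = pickAct (requests TR r)
  dropoff r = dropAct (requests TR r)

  request-picked-at : ∀ i → sgn Γ i ≡ pick → ∃ λ r → pickup r ≡ i
  request-picked-at i i-pick with covers TR i
  ... | r , inj₁ picked = r , picked
  ... | r , inj₂ refl with () ← trans (sym i-pick) (drop-ok TR r)

  request-dropped-at : ∀ i → sgn Γ i ≡ drop → ∃ λ r → dropoff r ≡ i
  request-dropped-at i i-drop with covers TR i
  ... | r , inj₂ dropped = r , dropped
  ... | r , inj₁ refl with () ← trans (sym (pick-ok TR r)) i-drop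

  loadAt : ℕ → ℕ
  loadAt = loadAfter (feasible Γ)

  loadAt-step : ∀ j → LoadStep L (sgn Γ j) (loadAt (toℕ j)) (loadAt (suc (toℕ j)))
  loadAt-step j = subst (λ s → LoadStep L s (loadAt (toℕ j)) (loadAt (suc (toℕ j))))
                        (lookup-signs (actions Γ) j) (loadAfter-step (feasible Γ) j)

  loadAt<L : ∀ {i} → sgn Γ i ≡ pick → loadAt (toℕ i) < L
  loadAt<L {i} i-pick with sgn Γ i | loadAt-step i
  ... | pick | (ℓ<L , _) = ℓ<L
  ... | drop | _ with () ← i-pick

  InTransitAfter : ℕ → Pred (Fin (m TR)) 0ℓ
  InTransitAfter t r = toℕ (pickup r) < t × t ≤ toℕ (dropoff r)

  inTransitAfter? : ∀ t → Decidable (InTransitAfter t)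
  inTransitAfter? t r = toℕ (pickup r) <? t ×-dec t ≤? toℕ (dropoff r)

  inTransitAfter : ℕ → ℕ
  inTransitAfter t = count (inTransitAfter? t)

  inTransit-pick : ∀ j → sgn Γ j ≡ pick →
                   inTransitAfter (suc (toℕ j)) ≤ suc (inTransitAfter (toℕ j))
  inTransit-pick j j-pick with request-picked-at j j-pick
  ... | r₀ , r₀-at-j =
    count-≤-suc (inTransitAfter? (toℕ j)) (inTransitAfter? (suc (toℕ j)))
                r₀ carried-before-or-picked
    where
    carried-before-or-picked : ∀ r → InTransitAfter (suc (toℕ j)) r →
                               InTransitAfter (toℕ j) r ⊎ r ≡ r₀
    carried-before-or-picked r (r<1+j , 1+j≤r) with m≤n⇒m<n∨m≡n (≤-pred r<1+j)
    ... | inj₁ r<j = inj₁ (r<j , <⇒≤ 1+j≤r)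
    ... | inj₂ r≡j = inj₂ (pick-inj TR (trans (toℕ-injective r≡j) (sym r₀-at-j)))

  inTransit-drop : ∀ j → sgn Γ j ≡ drop →
                   inTransitAfter (suc (toℕ j)) < inTransitAfter (toℕ j)
  inTransit-drop j j-drop with request-dropped-at j j-drop
  ... | r₁ , refl =
    count-mono-< (inTransitAfter? (suc (toℕ j))) (inTransitAfter? (toℕ j)) carried-before
                 r₁ (λ (_ , 1+j≤j) → 1+n≰n 1+j≤j) (order-ok TR r₁ , ≤-refl)
    where
    carried-before : InTransitAfter (suc (toℕ j)) ⊆ InTransitAfter (toℕ j)
    carried-before {r} (r<1+j , 1+j≤r) = ≤∧≢⇒< (≤-pred r<1+j) r≢j , <⇒≤ 1+j≤r
      where
      r≢j : toℕ (pickup r) ≢ toℕ j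
      r≢j r≡j with () ← trans (sym (pick-ok TR r))
                              (trans (cong (sgn Γ) (toℕ-injective r≡j)) j-drop)

  inTransit≤load : ∀ t → t ≤ n → inTransitAfter t ≤ loadAt t
  inTransit≤load zero _ = ≤-reflexive (count-empty (inTransitAfter? 0) λ r (r<0 , _) → n≮0 r<0)
  inTransit≤load (suc t) t<n with fromℕ< t<n | toℕ-fromℕ< t<n
  ... | j | refl = across-j (inTransit≤load (toℕ j) (<⇒≤ t<n))
    where
    across-j : inTransitAfter (toℕ j) ≤ loadAt (toℕ j) →
               inTransitAfter (suc (toℕ j)) ≤ loadAt (suc (toℕ j))
    across-j ih with sgn Γ j in j-sign | loadAt-step j
    ... | pick | (_ , load≡) =
      ≤-trans (inTransit-pick j j-sign) (≤-trans (s≤s ih) (≤-reflexive (sym load≡)))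
    ... | drop | load≡ =
      ≤-pred (≤-trans (inTransit-drop j j-sign) (≤-trans ih (≤-reflexive load≡)))

  JumpsOver : (Fin n → Bool) → Fin n → Pred (Fin (m TR)) 0ℓ
  JumpsOver vis i r = vis (pickup r) ≡ true × pickup r <ᶠ i × i <ᶠ dropoff r

  jumpsOver? : ∀ vis i → Decidable (JumpsOver vis i)
  jumpsOver? vis i r =
    vis (pickup r) Boolₚ.≟ true ×-dec pickup r Finₚ.<? i ×-dec i Finₚ.<? dropoff r

  jumpsOver : (Fin n → Bool) → Fin n → ℕ
  jumpsOver vis i = count (jumpsOver? vis i)

  jumpsOver<L : ∀ vis {i} → sgn Γ i ≡ pick → jumpsOver vis i < L
  jumpsOver<L vis {i} i-pick = begin-strict
    jumpsOver vis i         ≤⟨ count-mono (jumpsOver? vis i) (inTransitAfter? (toℕ i))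
                                          (λ (_ , r<i , i<r) → r<i , <⇒≤ i<r) ⟩
    inTransitAfter (toℕ i)  ≤⟨ inTransit≤load (toℕ i) (<⇒≤ (toℕ<n i)) ⟩
    loadAt (toℕ i)          <⟨ loadAt<L i-pick ⟩
    L                       ∎
    where open ≤-Reasoning

  jumpsOver-mark : ∀ p vis i → jumpsOver vis i ≤ jumpsOver (mark p vis) i
  jumpsOver-mark p vis i = count-mono (jumpsOver? vis i) (jumpsOver? (mark p vis) i)
    λ {r} (visited , over) → mark-mono p vis (pickup r) visited , over

  jumpsOver-mark-< : ∀ r vis {i} → vis (pickup r) ≡ false → pickup r <ᶠ i → i <ᶠ dropoff r →
                     jumpsOver vis i < jumpsOver (mark (pickup r) vis) i
  jumpsOver-mark-< r vis {i} r-unvisited r<i i<r =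
    count-mono-< (jumpsOver? vis i) (jumpsOver? (mark (pickup r) vis) i)
      (λ {r′} (visited , over) → mark-mono (pickup r) vis (pickup r′) visited , over) r
      (λ (visited , _) → Boolₚ.not-¬ visited r-unvisited)
      (mark-self (pickup r) vis , r<i , i<r)

  -- cnt zero counts the rounds started so far; the arcs from cur onwards have not yet been
  -- traversed in the current round.
  record Balanced (cur : Node n) (cnt : Node n → ℕ) : Set where
    field
      rounds≤L      : cnt zero ≤ L
      ≤rounds       : ∀ a → cnt a ≤ cnt zero
      ahead<rounds  : ∀ a → zero {n} <ᶠ cur → cur ≤ᶠ a → cnt a < cnt zero
  open Balanced

  balanced-step : ∀ {c cnt} → Balanced (suc c) cnt → Balanced (next (suc c)) (inc (suc c) cnt)
  balanced-step {c} {cnt} B = record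
    { rounds≤L     = rounds≤L B
    ; ≤rounds      = ≤rounds′
    ; ahead<rounds = ahead<rounds′
    }
    where
    ≤rounds′ : ∀ a → inc (suc c) cnt a ≤ cnt zero
    ≤rounds′ a with a Finₚ.≟ suc c
    ... | yes refl = ahead<rounds B (suc c) z<s ≤-refl
    ... | no _     = ≤rounds B a

    ahead<rounds′ : ∀ a → zero {n} <ᶠ next (suc c) → next (suc c) ≤ᶠ a →
                    inc (suc c) cnt a < cnt zero
    ahead<rounds′ a 0<next next≤a with next-cases (suc c)
    ... | inj₂ (_ , next≡0) = ⊥-elim (n≮0 (subst (λ k → 0 < toℕ k) next≡0 0<next))
    ... | inj₁ (_ , next≡) =
      ≤-trans (s≤s (≤-reflexive (inc-other (suc c) cnt (≢-sym (Finₚ.<⇒≢ c<a)))))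
              (ahead<rounds B a z<s (<⇒≤ c<a))
      where
      c<a : suc c <ᶠ a
      c<a = subst (_≤ toℕ a) next≡ next≤a

  Unvisited : (Fin n → Bool) → Fin n → Set
  Unvisited vis p = sgn Γ p ≡ pick × vis p ≡ false

  -- The current round has gone past p; at the depot every round has.
  Behind : Node n → Fin n → Set
  Behind cur p = cur ≡ zero ⊎ suc p <ᶠ cur

  record Invariant (cur : Node n) (vis : Fin n → Bool) (cnt : Node n → ℕ) : Set where
    field
      balanced       : Balanced cur cnt
      rounds≤1+jumps : ∀ p → Unvisited vis p → cnt zero ≤ suc (jumpsOver vis p)
      rounds≤jumps   : ∀ p → Unvisited vis p → Behind cur p → cnt zero ≤ jumpsOver vis p
  open Invariant

  invariant-start : Invariant zero (λ _ → false) (λ _ → 0)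
  invariant-start = record
    { balanced       = record
      { rounds≤L = z≤n ; ≤rounds = λ _ → z≤n ; ahead<rounds = λ _ () }
    ; rounds≤1+jumps = λ _ _ → z≤n
    ; rounds≤jumps   = λ _ _ _ → z≤n
    }

  invariant-leave-depot : ∀ {vis cnt} → ∃ (Unvisited vis) → Invariant zero vis cnt →
                          Invariant (next zero) vis (inc zero cnt)
  invariant-leave-depot {vis} {cnt} (p , p-unvisited) I = record
    { balanced = record
      { rounds≤L     = ≤-trans (s≤s (rounds≤jumps I p p-unvisited (inj₁ refl)))
                               (jumpsOver<L vis (proj₁ p-unvisited))
      ; ≤rounds      = ≤rounds′
      ; ahead<rounds = λ a 0<next next≤a →
          s≤s (≤-trans (≤-reflexive (inc-other zero cnt (a≢0 0<next next≤a))) (≤rounds B a))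
      }
    ; rounds≤1+jumps = λ q q-unvisited → s≤s (rounds≤jumps I q q-unvisited (inj₁ refl))
    ; rounds≤jumps   = λ q _ behind → ⊥-elim (n≮0 (<next⇒≤ behind))
    }
    where
    B = balanced I

    ≤rounds′ : ∀ a → inc zero cnt a ≤ suc (cnt zero)
    ≤rounds′ a with a Finₚ.≟ zero
    ... | yes refl = ≤-refl
    ... | no _     = m≤n⇒m≤1+n (≤rounds B a)

    a≢0 : ∀ {a} → zero {n} <ᶠ next zero → next zero ≤ᶠ a → a ≢ zero
    a≢0 0<next next≤a refl = n≮0 (<-≤-trans 0<next next≤a)

  invariant-tour-arc : ∀ {c vis cnt} → ¬ UnvisitedPickup (suc c) vis →
                       Invariant (suc c) vis cnt → Invariant (next (suc c)) vis (inc (suc c) cnt)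
  invariant-tour-arc {c} no-pickup-here I = record
    { balanced       = balanced-step (balanced I)
    ; rounds≤1+jumps = rounds≤1+jumps I
    ; rounds≤jumps   = λ p p-unvisited behind → rounds≤jumps I p p-unvisited
        (inj₂ (Finₚ.≤∧≢⇒< (<next⇒≤ behind)
                          λ p≡c → no-pickup-here (p , sym p≡c , p-unvisited)))
    }

  invariant-tour-step : ∀ {cur vis cnt} → ∃ (Unvisited vis) → ¬ UnvisitedPickup cur vis →
                        Invariant cur vis cnt → Invariant (next cur) vis (inc cur cnt)
  invariant-tour-step {zero}  some-unvisited _ = invariant-leave-depot some-unvisited
  invariant-tour-step {suc c} _ no-pickup-here = invariant-tour-arc no-pickup-here

  invariant-transport : ∀ r {vis cnt} → vis (pickup r) ≡ false →
                        Invariant (suc (pickup r)) vis cnt →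
                        Invariant (suc (dropoff r)) (mark (pickup r) vis) cnt
  invariant-transport r {vis} {cnt} r-unvisited I = record
    { balanced = record
      { rounds≤L     = rounds≤L B
      ; ≤rounds      = ≤rounds B
      ; ahead<rounds = λ a _ d≤a →
          ahead<rounds B a z<s (≤-trans (s≤s (<⇒≤ (order-ok TR r))) d≤a)
      }
    ; rounds≤1+jumps = λ p p-unvisited →
        ≤-trans (rounds≤1+jumps I p (still-unvisited p-unvisited))
                (s≤s (jumpsOver-mark (pickup r) vis p))
    ; rounds≤jumps   = rounds≤jumps′
    }
    where
    B = balanced I

    still-unvisited : ∀ {p} → Unvisited (mark (pickup r) vis) p → Unvisited vis p
    still-unvisited {p} (p-pick , p-unmarked) = p-pick , mark-false (pickup r) vis p p-unmarked

    rounds≤jumps′ : ∀ p → Unvisited (mark (pickup r) vis) p → Behind (suc (dropoff r)) p →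
                    cnt zero ≤ jumpsOver (mark (pickup r) vis) p
    rounds≤jumps′ p p-unvisited (inj₂ (s<s p<d)) with Finₚ.<-cmp p (pickup r)
    ... | tri< p<r _ _ = ≤-trans (rounds≤jumps I p (still-unvisited p-unvisited) (inj₂ (s<s p<r)))
                                 (jumpsOver-mark (pickup r) vis p)
    ... | tri≈ _ refl _ with () ← trans (sym (mark-self (pickup r) vis)) (proj₂ p-unvisited)
    ... | tri> _ _ r<p = ≤-trans (rounds≤1+jumps I p (still-unvisited p-unvisited))
                                 (jumpsOver-mark-< r vis r-unvisited r<p p<d)

  unvisited? : ∀ vis → Decidable (Unvisited vis)
  unvisited? vis p = is-pick? (sgn Γ p) ×-dec vis p Boolₚ.≟ false

  all-visited : ∀ {vis} → ¬ ∃ (Unvisited vis) → AllPickupsVisited vis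
  all-visited none i i-pick = Boolₚ.¬-not λ i-unvisited → none (i , i-pick , i-unvisited)

  not-all-visited : ∀ {vis} → ∃ (Unvisited vis) → ¬ AllPickupsVisited vis
  not-all-visited (p , p-pick , p-unvisited) all with () ← trans (sym (all p p-pick)) p-unvisited

  some-unvisited : ∀ {vis} → ¬ AllPickupsVisited vis → ∃ (Unvisited vis)
  some-unvisited {vis} not-all = decidable-stable (any? (unvisited? vis)) (not-all ∘ all-visited)

  unvisited-pickup? : ∀ cur vis → Dec (UnvisitedPickup cur vis)
  unvisited-pickup? zero    vis = no λ { (_ , () , _) }
  unvisited-pickup? (suc i) vis =
    map′ (λ u → i , refl , u) (λ { (_ , refl , u) → u }) (unvisited? vis i)

  loop-balanced : ∀ {cur vis cnt e cnt′} → Loop cur vis cnt e cnt′ → Invariant cur vis cnt →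
                  Balanced e cnt′
  loop-balanced (stop _)                       I = balanced I
  loop-balanced (viaTrans r _ r-unvisited lp)  I = loop-balanced lp (invariant-transport r r-unvisited I)
  loop-balanced (viaTour not-all no-pickup lp) I =
    loop-balanced lp (invariant-tour-step (some-unvisited not-all) no-pickup I)

  return-bounded : ∀ {cur cnt f} → Return cur cnt f → Balanced cur cnt → ∀ a → f a ≤ L
  return-bounded atDepot   B a = ≤-trans (≤rounds B a) (rounds≤L B)
  return-bounded (step rt) B   = return-bounded rt (balanced-step B)

  notVisited? : (vis : Fin n → Bool) → Decidable (λ p → vis p ≡ false)
  notVisited? vis p = vis p Boolₚ.≟ false

  traversalBudget : ℕ
  traversalBudget = sum (λ (_ : Node n) → L)

  measure : (Fin n → Bool) → (Node n → ℕ) → ℕ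
  measure vis cnt = (traversalBudget ∸ sum cnt) + count (notVisited? vis)

  measure-tour : ∀ {cur vis cnt} → Balanced (next cur) (inc cur cnt) →
                 measure vis (inc cur cnt) < measure vis cnt
  measure-tour {cur} {vis} {cnt} B = +-monoˡ-< _ (∸-monoʳ-< more-traversals bounded)
    where
    more-traversals : sum cnt < sum (inc cur cnt)
    more-traversals = sum-mono-< (≤-inc cur cnt) cur (≤-reflexive (sym (inc-self cur cnt)))
    bounded : sum (inc cur cnt) ≤ traversalBudget
    bounded = sum-mono λ a → ≤-trans (≤rounds B a) (rounds≤L B)

  measure-mark : ∀ {p vis} cnt → vis p ≡ false → measure (mark p vis) cnt < measure vis cnt
  measure-mark {p} {vis} cnt p-unvisited = +-monoʳ-< (traversalBudget ∸ sum cnt)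
    (count-mono-< (notVisited? (mark p vis)) (notVisited? vis)
                  (λ {q} → mark-false p vis q) p (Boolₚ.not-¬ (mark-self p vis)) p-unvisited)

  loop-exists : ∀ fuel cur vis cnt → Invariant cur vis cnt → measure vis cnt < fuel →
                ∃₂ (Loop cur vis cnt)
  loop-exists zero       _   _   _   _ ()
  loop-exists (suc fuel) cur vis cnt I m<fuel with any? (unvisited? vis)
  ... | no none = cur , cnt , stop (all-visited none)
  ... | yes some with unvisited-pickup? cur vis
  ...   | no no-pickup =
    Product.map₂ (Product.map₂ (viaTour (not-all-visited some) no-pickup))
      (loop-exists fuel (next cur) vis (inc cur cnt) I′
                   (<-≤-trans (measure-tour (balanced I′)) (≤-pred m<fuel)))
    where I′ = invariant-tour-step some no-pickup I
  ...   | yes (i , refl , i-pick , i-unvisited) with request-picked-at i i-pick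
  ...     | r , refl =
    Product.map₂ (Product.map₂ (viaTrans r (not-all-visited some) i-unvisited))
      (loop-exists fuel (suc (dropoff r)) (mark i vis) cnt (invariant-transport r i-unvisited I)
                   (<-≤-trans (measure-mark cnt i-unvisited) (≤-pred m<fuel)))

  return-exists : ∀ d (cur : Node n) cnt → toℕ cur + d ≡ n → ∃ (Return cur cnt)
  return-exists _       zero    cnt _ = cnt , atDepot
  return-exists zero    (suc i) cnt at-end =
    inc (suc i) cnt ,
    step (subst (λ k → Return k (inc (suc i) cnt) (inc (suc i) cnt)) (sym next≡0) atDepot)
    where
    next≡0 : next (suc i) ≡ zero
    next≡0 = next-last (suc i) (trans (sym (+-identityʳ _)) at-end)
  return-exists (suc d) (suc i) cnt distance =
    Product.map₂ step (return-exists d (next (suc i)) (inc (suc i) cnt) distance′)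
    where
    distance′ : toℕ (next (suc i)) + d ≡ n
    distance′ = begin
      toℕ (next (suc i)) + d   ≡⟨ cong (_+ d) (toℕ-next (suc i) i<n) ⟩
      suc (toℕ (suc i)) + d    ≡⟨ sym (+-suc _ d) ⟩
      toℕ (suc i) + suc d      ≡⟨ distance ⟩
      n                        ∎
      where
      open ≡-Reasoning
      i<n : toℕ (suc i) < n
      i<n = subst (toℕ (suc i) <_) distance (m<m+n _ z<s)

  traverse-counter-exists : ∃ TraverseCounter
  traverse-counter-exists with loop-exists _ zero (λ _ → false) (λ _ → 0) invariant-start ≤-refl
  ... | e , cnt , lp with return-exists (n ∸ toℕ e) e cnt (m+[n∸m]≡n (≤-pred (toℕ<n e)))
  ...   | f , rt = f , e , cnt , lp , rt

  traverse-counter-bounded : ∀ {f} → TraverseCounter f → ∀ a → f a ≤ L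
  traverse-counter-bounded (_ , _ , lp , rt) = return-bounded rt (loop-balanced lp invariant-start)

lemma2 : {V : Set} (vD : V) (L n : ℕ) (Γ : UniformTour V vD L n)
    (TR : TransportRequests Γ) →
    Σ (Node n → ℕ) (Construction.TraverseCounter Γ TR)
    × ((f : Node n → ℕ) → Construction.TraverseCounter Γ TR f →
       ((a : Node n) → f a ≤ L + 1)
       × ((i : Fin n) → sgn Γ i ≡ drop → f (Fin.suc i) ≤ L + 1)
       × ((i : Fin n) → sgn Γ i ≡ pick → f (Fin.suc i) ≤ L))
lemma2 vD L n Γ TR = traverse-counter-exists Γ TR , λ f counter →
  let f≤L = traverse-counter-bounded Γ TR counter in
  (λ a → ≤-trans (f≤L a) (m≤m+n L 1)) ,
  (λ i _ → ≤-trans (f≤L (suc i)) (m≤m+n L 1)) ,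
  (λ i _ → f≤L (suc i))
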